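{- Let $r\ge 4$ and $n\in\mathbb{N}$ with $(r-2)\mid n$. Let $I$ be a subgraph of $K_{r,2,n}$ with $\ell\le n/(2r)$ edges and $c$ components. Then \[|V(I)|-c\ge\frac{2}{r+1}\ell+\frac{c}{r+1}.\]
   Context: For $r\ge 3$ and $(r-2)\mid n$, $K_{r,2,n}$ is the graph on $\mathbb{Z}_n=\{0,\dots,n-1\}$ whose edge set is the union of the edge sets of the $n/(r-2)$ cliques $K_r$ on the vertex sets $\{i(r-2),\dots,i(r-2)+r-1\}$ (mod $n$), $i\in\{0,\dots,n/(r-2)-1\}$. A subgraph $I$ is identified with its edge set; $V(I)$ is the set of vertices incident to edges of $I$, and $c$ counts the connected components of $I$ (each containing at least one edge). -}

module Defs where

open import Data.Nat using (ℕ; zero; suc; _+_; _*_; _∸_; _<_; _≤_)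
open import Data.Nat.DivMod using (_%_)
open import Data.Fin using (Fin; toℕ; _≟_)
open import Data.Fin.Properties using (all?)
open import Data.Product using (Σ; ∃; ∃-syntax; _×_; _,_; proj₁; proj₂)
open import Data.Sum using (_⊎_; inj₁; inj₂)
open import Data.Empty using (⊥)
open import Data.List using (List; length; filter; []; _∷_)
open import Data.List.Relation.Unary.Any using (Any; any?)
open import Data.List.Relation.Unary.All using (All)
open import Data.List.Relation.Unary.Unique.Propositional using (Unique)
open import Data.List using () renaming (map to lmap)
open import Data.Fin using () renaming (zero to fzero)
open import Data.List.Base using ()
open import Relation.Binary.PropositionalEquality using (_≡_)
open import Relation.Nullary using (¬_)
open import Relation.Nullary.Decidable using (_⊎-dec_)
open import Relation.Binary.Construct.Closure.ReflexiveTransitive using (Star)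
open import Function.Bundles using (_⇔_)
open import Function.Definitions using (Surjective)
import Data.List as L
open import Data.Fin.Base using () renaming (Fin to F)

-- Vertex set Z_n is Fin n; a vertex x ∈ Fin (suc m) represents the residue toℕ x.
-- "Vertex u lies in the i-th clique {i(r-2), ..., i(r-2)+r-1} (mod n)".
InClique : (r : ℕ) {n : ℕ} → ℕ → Fin n → Set
InClique r {zero}  i ()
InClique r {suc m} i u = ∃[ a ] (a < r × toℕ u ≡ (i * (r ∸ 2) + a) % suc m)

-- Adjacency in K_{r,2,n}: u ≠ v and both lie in a common clique with
-- index i ∈ {0, ..., n/(r-2) - 1}, i.e. i * (r-2) < n (given (r-2) ∣ n).
Adj : (r n : ℕ) → Fin n → Fin n → Set
Adj r n u v = ¬ (u ≡ v) × ∃[ i ] (i * (r ∸ 2) < n × InClique r i u × InClique r i v)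

-- An edge is stored as an ordered pair (u , v) with toℕ u < toℕ v.
Edge : ℕ → Set
Edge n = Fin n × Fin n

IsSubgraph : (r n : ℕ) → List (Edge n) → Set
IsSubgraph r n es =
  Unique es × All (λ e → toℕ (proj₁ e) < toℕ (proj₂ e) × Adj r n (proj₁ e) (proj₂ e)) es

Incident : {n : ℕ} → Fin n → Edge n → Set
Incident v e = v ≡ proj₁ e ⊎ v ≡ proj₂ e

InV : {n : ℕ} → List (Edge n) → Fin n → Set
InV es v = Any (Incident v) es

numV : {n : ℕ} → List (Edge n) → ℕ
numV {n} es = length (filter (λ v → any? (λ e → (v ≟ proj₁ e) ⊎-dec (v ≟ proj₂ e)) es) (L.allFin n))

Step : {n : ℕ} → List (Edge n) → Fin n → Fin n → Set
Step es u v = Any (λ e → (u ≡ proj₁ e × v ≡ proj₂ e) ⊎ (u ≡ proj₂ e × v ≡ proj₁ e)) es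

Connected : {n : ℕ} → List (Edge n) → Fin n → Fin n → Set
Connected es = Star (Step es)

VI : {n : ℕ} → List (Edge n) → Set
VI {n} es = Σ (Fin n) (InV es)

NumComponents : {n : ℕ} → List (Edge n) → ℕ → Set
NumComponents {n} es c =
  Σ (VI es → Fin c) λ f →
    Surjective _≡_ _≡_ f ×
    (∀ x y → (f x ≡ f y) ⇔ Connected es (proj₁ x) (proj₁ y))

-- Put w = r − 2 and k = n/w; the i-th clique is {iw, …, iw + w + 1}, so consecutive cliques
-- overlap in the pairs {iw, iw + 1}. Since ℓ(2r) ≤ n, the graph I has at most 2ℓ < k vertices,
-- so some overlap {i₀w, i₀w + 1} misses V(I). Rotating Z_n to put i₀w at 0 places V(I) in the
-- positions ≥ 2 of a linear chain of cliques that no longer wraps around. Split the chain into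
-- blocks [Jw + 2, Jw + w + 2) and add them one at a time: a block holding t vertices of a set S,
-- preceded by an overlap holding x ≤ 2 of them, adds at most x t + t(t − 1)/2 edges, and this
-- keeps 2|E| + (w + 4) ≤ (w + 3)|S| once |S| ≥ 2. Every component of I has at least two
-- vertices, so summing over the c components gives 2ℓ + c(w + 4) ≤ (w + 3)|V(I)|, which is the
-- claim because w + 3 = r + 1.

module Submission where

open import Defs
import Data.Nat as ℕ
open import Data.Nat using (ℕ; zero; suc; _+_; _*_; _∸_; _≤_; _<_; z≤n; s≤s; _≤?_; _<?_; NonZero; >-nonZero)
open import Data.Bool using (Bool; true; false; T; if_then_else_)
open import Data.Bool.Properties using (T?)
open import Data.Empty using (⊥-elim)
open import Data.Fin as Fin using (Fin; toℕ)
open import Data.Fin.Properties using (toℕ-injective; toℕ<n; toℕ-fromℕ<; all?; ¬∀⟶∃¬)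
open import Data.List using (List; []; _∷_; _++_; length; map; filter; allFin)
open import Data.List.Extrema.Nat using (max; xs≤max)
open import Data.List.Membership.DecPropositional ℕ._≟_ using (_∈?_)
open import Data.List.Membership.Propositional using (_∈_; find)
open import Data.List.Membership.Propositional.Properties
  using (∈-∃++; ∈-++⁻; ∈-++⁺ˡ; ∈-++⁺ʳ; ∈-map⁺; ∈-map⁻; ∈-filter⁺; ∈-filter⁻; ∈-allFin)
open import Data.List.Properties using (length-++; length-++-sucʳ; length-map; length-tabulate; filter-accept; filter-reject)
open import Data.List.Relation.Unary.All as All using (All; []; _∷_)
open import Data.List.Relation.Unary.AllPairs using ([]; _∷_)
open import Data.List.Relation.Unary.Any as Any using (here; there; any?)
open import Data.List.Relation.Unary.Unique.Propositional using (Unique)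
import Data.List.Relation.Unary.Unique.Propositional.Properties as Unique
open import Data.Nat.DivMod
open import Data.Nat.Divisibility using (_∣_; divides)
open import Data.Nat.Properties hiding (_≟_)
open import Data.Nat.Tactic.RingSolver using (solve-∀)
open import Data.Product using (∃; _×_; _,_; proj₁; proj₂; swap)
open import Data.Product.Properties using (,-injectiveˡ; ,-injectiveʳ)
open import Data.Sum using (_⊎_; inj₁; inj₂)
open import Function using (id; _∘′_)
open import Function.Bundles using (Equivalence)
open import Relation.Binary.Construct.Closure.ReflexiveTransitive using (ε; _◅_)
open import Relation.Binary.PropositionalEquality
open import Relation.Nullary using (¬_; yes; no; Dec)
open import Relation.Nullary.Decidable using (isYes; fromWitness; toWitness; _⊎-dec_)

Unique⇒length≤ : {A : Set} (xs ys : List A) → Unique xs → (∀ {x} → x ∈ xs → x ∈ ys) →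
  length xs ≤ length ys
Unique⇒length≤ [] ys _ _ = z≤n
Unique⇒length≤ (x ∷ xs) ys (x∉xs ∷ uxs) xs⊆ys with ∈-∃++ (xs⊆ys (here refl))
... | ys₁ , ys₂ , refl = subst (suc (length xs) ≤_) (sym (length-++-sucʳ ys₁ x ys₂))
  (s≤s (Unique⇒length≤ xs (ys₁ ++ ys₂) uxs xs⊆ys₁ys₂))
  where
  xs⊆ys₁ys₂ : ∀ {y} → y ∈ xs → y ∈ ys₁ ++ ys₂
  xs⊆ys₁ys₂ {y} y∈xs with ∈-++⁻ ys₁ (xs⊆ys (there y∈xs))
  ... | inj₁ y∈ys₁ = ∈-++⁺ˡ y∈ys₁
  ... | inj₂ (here refl) = ⊥-elim (All.lookup x∉xs y∈xs refl)
  ... | inj₂ (there y∈ys₂) = ∈-++⁺ʳ ys₁ y∈ys₂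

Unique-map⁺ : {A B : Set} (f : A → B) (xs : List A) → Unique xs →
  (∀ {x y} → x ∈ xs → y ∈ xs → f x ≡ f y → x ≡ y) → Unique (map f xs)
Unique-map⁺ f [] _ _ = []
Unique-map⁺ f (x ∷ xs) (x∉xs ∷ uxs) inj =
  map-≢ xs x∉xs (λ y∈xs → inj (here refl) (there y∈xs)) ∷
  Unique-map⁺ f xs uxs (λ p q → inj (there p) (there q))
  where
  map-≢ : ∀ ys → All (λ y → ¬ x ≡ y) ys → (∀ {y} → y ∈ ys → f x ≡ f y → x ≡ y) →
    All (λ z → ¬ f x ≡ z) (map f ys)
  map-≢ [] [] _ = []
  map-≢ (y ∷ ys) (x≢y ∷ x≢ys) inj′ = (λ e → x≢y (inj′ (here refl) e)) ∷ map-≢ ys x≢ys (λ p → inj′ (there p))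

2≤length : {A : Set} {xs : List A} {a b : A} → ¬ a ≡ b → a ∈ xs → b ∈ xs → 2 ≤ length xs
2≤length {xs = xs} a≢b a∈ b∈ = Unique⇒length≤ (_ ∷ _ ∷ []) xs ((a≢b ∷ []) ∷ [] ∷ [])
  (λ { (here refl) → a∈ ; (there (here refl)) → b∈ })

∑< : ℕ → (ℕ → ℕ) → ℕ
∑< zero  f = 0
∑< (suc c) f = ∑< c f + f c

∑-cong : ∀ c {f g} → (∀ j → j < c → f j ≡ g j) → ∑< c f ≡ ∑< c g
∑-cong zero    _   = refl
∑-cong (suc c) f≗g = cong₂ _+_ (∑-cong c (λ j j<c → f≗g j (m<n⇒m<1+n j<c))) (f≗g c ≤-refl)

∑-mono-≤ : ∀ c {f g} → (∀ j → j < c → f j ≤ g j) → ∑< c f ≤ ∑< c g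
∑-mono-≤ zero    _   = z≤n
∑-mono-≤ (suc c) f≤g = +-mono-≤ (∑-mono-≤ c (λ j j<c → f≤g j (m<n⇒m<1+n j<c))) (f≤g c ≤-refl)

∑-+ : ∀ c f g → ∑< c (λ j → f j + g j) ≡ ∑< c f + ∑< c g
∑-+ zero    f g = refl
∑-+ (suc c) f g rewrite ∑-+ c f g = +-+-comm (∑< c f) (∑< c g) (f c) (g c)
  where
  +-+-comm : ∀ a b x y → a + b + (x + y) ≡ a + x + (b + y)
  +-+-comm = solve-∀

∑-*ˡ : ∀ c a f → ∑< c (λ j → a * f j) ≡ a * ∑< c f
∑-*ˡ zero    a f = sym (*-zeroʳ a)
∑-*ˡ (suc c) a f rewrite ∑-*ˡ c a f = sym (*-distribˡ-+ a (∑< c f) (f c))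

∑-const : ∀ c b → ∑< c (λ _ → b) ≡ c * b
∑-const zero    b = refl
∑-const (suc c) b rewrite ∑-const c b = +-comm (c * b) b

∑-zero : ∀ c → ∑< c (λ _ → 0) ≡ 0
∑-zero zero    = refl
∑-zero (suc c) = cong (_+ 0) (∑-zero c)

δ : ℕ → ℕ → ℕ
δ x j with x ℕ.≟ j
... | yes _ = 1
... | no  _ = 0

δ-≢ : ∀ {x j} → ¬ x ≡ j → δ x j ≡ 0
δ-≢ {x} {j} x≢j with x ℕ.≟ j
... | yes x≡j = ⊥-elim (x≢j x≡j)
... | no  _   = refl

∑-δ : ∀ x c → x < c → ∑< c (δ x) ≡ 1
∑-δ x (suc c) x<1+c with m≤n⇒m<n∨m≡n (≤-pred x<1+c)
... | inj₁ x<c  = cong₂ _+_ (∑-δ x c x<c) (δ-≢ (<⇒≢ x<c))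
... | inj₂ refl = cong₂ _+_ (trans (∑-cong x (λ j j<x → δ-≢ (≢-sym (<⇒≢ j<x)))) (∑-zero x)) δ-refl
  where
  δ-refl : δ x x ≡ 1
  δ-refl with x ℕ.≟ x
  ... | yes _   = refl
  ... | no  x≢x = ⊥-elim (x≢x refl)

module _ {A : Set} (g : A → ℕ) where

  fibre : ℕ → List A → List A
  fibre j = filter (λ x → g x ℕ.≟ j)

  length-fibre-∷ : ∀ x xs j → length (fibre j (x ∷ xs)) ≡ δ (g x) j + length (fibre j xs)
  length-fibre-∷ x xs j with g x ℕ.≟ j
  ... | yes gx≡j = cong length (filter-accept (λ x → g x ℕ.≟ j) gx≡j)
  ... | no  gx≢j = cong length (filter-reject (λ x → g x ℕ.≟ j) gx≢j)

  length≡∑-fibres : ∀ c xs → (∀ {x} → x ∈ xs → g x < c) → length xs ≡ ∑< c (λ j → length (fibre j xs))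
  length≡∑-fibres c [] _ = sym (∑-zero c)
  length≡∑-fibres c (x ∷ xs) g<c = sym (begin
      ∑< c (λ j → length (fibre j (x ∷ xs)))          ≡⟨ ∑-cong c (λ j _ → length-fibre-∷ x xs j) ⟩
      ∑< c (λ j → δ (g x) j + length (fibre j xs))     ≡⟨ ∑-+ c (δ (g x)) (λ j → length (fibre j xs)) ⟩
      ∑< c (δ (g x)) + ∑< c (λ j → length (fibre j xs)) ≡⟨ cong₂ _+_ (∑-δ (g x) c (g<c (here refl)))
                                                             (sym (length≡∑-fibres c xs (λ p → g<c (there p)))) ⟩
      suc (length xs)                                    ∎)
    where open ≡-Reasoning

-- Edge counts in a linear chain of cliques

m+o≡n⇒m≤n : ∀ {m n} o → m + o ≡ n → m ≤ n
m+o≡n⇒m≤n {m} o refl = m≤m+n m o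

-- 2|E| + deficit w |S| ≤ (w + 3)|S| is the invariant of the block-by-block count; for |S| ≥ 2
-- it is the bound we want.
deficit : ℕ → ℕ → ℕ
deficit w zero          = 0
deficit w (suc zero)    = w + 3
deficit w (suc (suc _)) = w + 4

deficit≤ : ∀ w v → deficit w v ≤ (w + 3) * v
deficit≤ w zero          = z≤n
deficit≤ w (suc zero)    = ≤-reflexive (sym (*-identityʳ (w + 3)))
deficit≤ w (suc (suc v)) = m+o≡n⇒m≤n (w + 2 + (w + 3) * v) (identity w v)
  where
  identity : ∀ w v → w + 4 + (w + 2 + (w + 3) * v) ≡ (w + 3) * (2 + v)
  identity = solve-∀

deficit-absorbs-block : ∀ w V x k → x ≤ 2 → x ≤ V → k ≤ w →
  deficit w (V + k) + 2 * x * k + k * k ≤ deficit w V + (w + 4) * k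
deficit-absorbs-block w (suc (suc V)) x k x≤2 _ k≤w = begin
    w + 4 + 2 * x * k + k * k   ≡⟨ +-assoc (w + 4) (2 * x * k) (k * k) ⟩
    w + 4 + (2 * x * k + k * k) ≤⟨ +-monoʳ-≤ (w + 4) (+-mono-≤ (*-monoˡ-≤ k (*-monoʳ-≤ 2 x≤2)) (*-monoˡ-≤ k k≤w)) ⟩
    w + 4 + (4 * k + w * k)     ≡⟨ cong (w + 4 +_) (trans (sym (*-distribʳ-+ k 4 w)) (cong (_* k) (+-comm 4 w))) ⟩
    w + 4 + (w + 4) * k         ∎
  where open ≤-Reasoning
deficit-absorbs-block w V x zero _ _ _
  rewrite +-identityʳ V | *-zeroʳ (2 * x) | *-zeroʳ (w + 4) = ≤-reflexive (+-identityʳ (deficit w V + 0))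
deficit-absorbs-block w zero zero (suc zero) _ _ _ = ≤-reflexive (identity w)
  where
  identity : ∀ w → w + 3 + 2 * 0 * 1 + 1 * 1 ≡ 0 + (w + 4) * 1
  identity = solve-∀
deficit-absorbs-block w zero zero (suc (suc a)) _ _ k≤w with m≤n⇒∃[o]m+o≡n k≤w
... | b , refl = m+o≡n⇒m≤n (2 + 3 * a + b + a * b) (identity a b)
  where
  identity : ∀ a b → (2 + a + b) + 4 + 2 * 0 * (2 + a) + (2 + a) * (2 + a) + (2 + 3 * a + b + a * b)
                     ≡ 0 + ((2 + a + b) + 4) * (2 + a)
  identity = solve-∀
deficit-absorbs-block w (suc zero) x (suc a) _ x≤1 k≤w with m≤n⇒∃[o]m+o≡n k≤w
... | b , refl = begin
    (1 + a + b) + 4 + 2 * x * (1 + a) + (1 + a) * (1 + a)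
      ≤⟨ +-monoˡ-≤ ((1 + a) * (1 + a)) (+-monoʳ-≤ ((1 + a + b) + 4) (*-monoˡ-≤ (1 + a) (*-monoʳ-≤ 2 x≤1))) ⟩
    (1 + a + b) + 4 + 2 * 1 * (1 + a) + (1 + a) * (1 + a)
      ≤⟨ m+o≡n⇒m≤n (1 + 2 * a + b + a * b) (identity a b) ⟩
    (1 + a + b) + 3 + ((1 + a + b) + 4) * (1 + a) ∎
  where
  open ≤-Reasoning
  identity : ∀ a b → (1 + a + b) + 4 + 2 * 1 * (1 + a) + (1 + a) * (1 + a) + (1 + 2 * a + b + a * b)
                     ≡ (1 + a + b) + 3 + ((1 + a + b) + 4) * (1 + a)
  identity = solve-∀

fromBool : Bool → ℕ
fromBool true  = 1
fromBool false = 0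

fromBool≤1 : ∀ b → fromBool b ≤ 1
fromBool≤1 true  = ≤-refl
fromBool≤1 false = z≤n

fromBool-idem : ∀ b → fromBool b * fromBool b ≡ fromBool b
fromBool-idem true  = refl
fromBool-idem false = refl

range : ℕ → ℕ → List ℕ
range lo zero    = []
range lo (suc m) = lo ∷ range (suc lo) m

∈-range⁺ : ∀ lo m {a} → lo ≤ a → a < lo + m → a ∈ range lo m
∈-range⁺ lo zero    lo≤a a<lo+0 = ⊥-elim (<⇒≱ (<-≤-trans a<lo+0 (≤-reflexive (+-identityʳ lo))) lo≤a)
∈-range⁺ lo (suc m) lo≤a a<lo+1+m with m≤n⇒m<n∨m≡n lo≤a
... | inj₂ refl = here refl
... | inj₁ lo<a = there (∈-range⁺ (suc lo) m lo<a (<-≤-trans a<lo+1+m (≤-reflexive (+-suc lo m))))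

∈-range⁻ : ∀ lo m {a} → a ∈ range lo m → lo ≤ a
∈-range⁻ lo (suc m) (here refl) = ≤-refl
∈-range⁻ lo (suc m) (there a∈) = <⇒≤ (∈-range⁻ (suc lo) m a∈)

Unique-range : ∀ lo m → Unique (range lo m)
Unique-range lo zero    = []
Unique-range lo (suc m) = All.tabulate (λ a∈ → <⇒≢ (∈-range⁻ (suc lo) m a∈)) ∷ Unique-range (suc lo) m

module Counting (χ : ℕ → Bool) where

  count : ℕ → ℕ → ℕ
  count lo zero    = 0
  count lo (suc m) = fromBool (χ lo) + count (suc lo) m

  count-+ : ∀ lo a b → count lo (a + b) ≡ count lo a + count (lo + a) b
  count-+ lo zero    b rewrite +-identityʳ lo = refl
  count-+ lo (suc a) b rewrite count-+ (suc lo) a b | +-suc lo a = sym (+-assoc (fromBool (χ lo)) _ _)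

  count-suc : ∀ lo m → count lo (suc m) ≡ count lo m + fromBool (χ (lo + m))
  count-suc lo m = trans (cong (count lo) (+-comm 1 m)) (trans (count-+ lo m 1) (cong (count lo m +_) (+-identityʳ _)))

  count≤ : ∀ lo m → count lo m ≤ m
  count≤ lo zero    = z≤n
  count≤ lo (suc m) = +-mono-≤ (fromBool≤1 (χ lo)) (count≤ (suc lo) m)

  χ? : ∀ a → Dec (T (χ a))
  χ? a = T? (χ a)

  length-filter-range : ∀ lo m → length (filter χ? (range lo m)) ≡ count lo m
  length-filter-range lo zero = refl
  length-filter-range lo (suc m) with χ lo
  ... | true  = cong suc (length-filter-range (suc lo) m)
  ... | false = length-filter-range (suc lo) m

  pairsEndingAt : ℕ → ℕ → List (ℕ × ℕ)
  pairsEndingAt L t = if χ (L + t) then map (_, L + t) (filter χ? (range L t)) else []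

  -- The candidate edges whose larger end b lies in [L + 2, L + 2 + m) and whose smaller end
  -- lies in [L, b); with L = Jw these are the edges charged to block J.
  blockPairs : ℕ → ℕ → List (ℕ × ℕ)
  blockPairs L zero    = []
  blockPairs L (suc m) = blockPairs L m ++ pairsEndingAt L (2 + m)

  chainPairs : ℕ → ℕ → List (ℕ × ℕ)
  chainPairs w zero    = []
  chainPairs w (suc N) = chainPairs w N ++ blockPairs (N * w) w

  length-pairsEndingAt : ∀ L t → length (pairsEndingAt L t) ≡ fromBool (χ (L + t)) * count L t
  length-pairsEndingAt L t with χ (L + t)
  ... | true  = trans (length-map _ (filter χ? (range L t))) (trans (length-filter-range L t) (sym (+-identityʳ _)))
  ... | false = refl

  -- With x = count L 2 and k = count (L + 2) m: |blockPairs L m| = x k + k(k − 1)/2, doubled.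
  length-blockPairs : ∀ L m →
    2 * length (blockPairs L m) + count (L + 2) m ≡ 2 * count L 2 * count (L + 2) m + count (L + 2) m * count (L + 2) m
  length-blockPairs L zero = base (count L 2)
    where
    base : ∀ x → 2 * 0 + 0 ≡ 2 * x * 0 + 0 * 0
    base = solve-∀
  length-blockPairs L (suc m) = begin
      2 * length (blockPairs L m ++ pairsEndingAt L (2 + m)) + count (L + 2) (suc m)
        ≡⟨ cong₂ (λ a b → 2 * a + b) (length-++ (blockPairs L m)) (count-suc (L + 2) m) ⟩
      2 * (Q + length (pairsEndingAt L (2 + m))) + (k + c)
        ≡⟨ cong (λ a → 2 * (Q + a) + (k + c)) (length-pairsEndingAt L (2 + m)) ⟩
      2 * (Q + fromBool (χ (L + (2 + m))) * count L (2 + m)) + (k + c)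
        ≡⟨ cong₂ (λ a b → 2 * (Q + fromBool (χ a) * b) + (k + c)) (sym (+-assoc L 2 m)) (count-+ L 2 m) ⟩
      2 * (Q + c * (x + k)) + (k + c)
        ≡⟨ step Q c x k (length-blockPairs L m) (fromBool-idem _) ⟩
      2 * x * (k + c) + (k + c) * (k + c)
        ≡⟨ cong (λ a → 2 * x * a + a * a) (sym (count-suc (L + 2) m)) ⟩
      2 * x * count (L + 2) (suc m) + count (L + 2) (suc m) * count (L + 2) (suc m) ∎
    where
    open ≡-Reasoning
    Q x k c : ℕ
    Q = length (blockPairs L m)
    x = count L 2
    k = count (L + 2) m
    c = fromBool (χ (L + 2 + m))
    step : ∀ Q c x k → 2 * Q + k ≡ 2 * x * k + k * k → c * c ≡ c →
      2 * (Q + c * (x + k)) + (k + c) ≡ 2 * x * (k + c) + (k + c) * (k + c)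
    step Q c x k ih cc = begin
        2 * (Q + c * (x + k)) + (k + c)                   ≡⟨ split Q c x k ⟩
        (2 * Q + k) + (2 * c * x + 2 * c * k + c)         ≡⟨ cong₂ (λ a b → a + (2 * c * x + 2 * c * k + b)) ih (sym cc) ⟩
        2 * x * k + k * k + (2 * c * x + 2 * c * k + c * c) ≡⟨ join c x k ⟩
        2 * x * (k + c) + (k + c) * (k + c)                ∎
      where
      split : ∀ Q c x k → 2 * (Q + c * (x + k)) + (k + c) ≡ (2 * Q + k) + (2 * c * x + 2 * c * k + c)
      split = solve-∀
      join : ∀ c x k → 2 * x * k + k * k + (2 * c * x + 2 * c * k + c * c) ≡ 2 * x * (k + c) + (k + c) * (k + c)
      join = solve-∀

  chainPairs-bound : ∀ w N → 2 * length (chainPairs w N) + deficit w (count 0 (N * w + 2)) ≤ (w + 3) * count 0 (N * w + 2)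
  chainPairs-bound w zero = deficit≤ w (count 0 2)
  chainPairs-bound w (suc N) =
    subst (λ z → 2 * length (chainPairs w N ++ blockPairs (N * w) w) + deficit w (count 0 z) ≤ (w + 3) * count 0 z)
      (extend N w) (+-cancelʳ-≤ k _ _ (begin
        2 * length (chainPairs w N ++ blockPairs (N * w) w) + deficit w (count 0 (N * w + 2 + w)) + k
          ≡⟨ cong₂ (λ a b → 2 * a + deficit w b + k) (length-++ (chainPairs w N)) (count-+ 0 (N * w + 2) w) ⟩
        2 * (E + Q) + deficit w (V + k) + k                   ≡⟨ regroup₁ E Q k (deficit w (V + k)) ⟩
        2 * E + ((2 * Q + k) + deficit w (V + k))             ≡⟨ cong (λ a → 2 * E + (a + deficit w (V + k))) (length-blockPairs (N * w) w) ⟩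
        2 * E + (2 * x * k + k * k + deficit w (V + k))       ≡⟨ cong (2 * E +_) (regroup₂ (2 * x * k) (k * k) (deficit w (V + k))) ⟩
        2 * E + (deficit w (V + k) + 2 * x * k + k * k)       ≤⟨ +-monoʳ-≤ (2 * E) (deficit-absorbs-block w V x k x≤2 x≤V k≤w) ⟩
        2 * E + (deficit w V + (w + 4) * k)                   ≡⟨ sym (+-assoc (2 * E) (deficit w V) _) ⟩
        2 * E + deficit w V + (w + 4) * k                     ≤⟨ +-monoˡ-≤ ((w + 4) * k) (chainPairs-bound w N) ⟩
        (w + 3) * V + (w + 4) * k                             ≡⟨ regroup₃ w V k ⟩
        (w + 3) * (V + k) + k                                 ≡⟨ cong (λ b → (w + 3) * b + k) (sym (count-+ 0 (N * w + 2) w)) ⟩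
        (w + 3) * count 0 (N * w + 2 + w) + k                 ∎))
    where
    open ≤-Reasoning
    E Q V k x : ℕ
    E = length (chainPairs w N)
    Q = length (blockPairs (N * w) w)
    V = count 0 (N * w + 2)
    k = count (N * w + 2) w
    x = count (N * w) 2
    x≤2 : x ≤ 2
    x≤2 = count≤ (N * w) 2
    x≤V : x ≤ V
    x≤V = subst (x ≤_) (sym (count-+ 0 (N * w) 2)) (m≤n+m x (count 0 (N * w)))
    k≤w : k ≤ w
    k≤w = count≤ (N * w + 2) w
    extend : ∀ N w → N * w + 2 + w ≡ suc N * w + 2
    extend = solve-∀
    regroup₁ : ∀ E Q k D → 2 * (E + Q) + D + k ≡ 2 * E + ((2 * Q + k) + D)
    regroup₁ = solve-∀
    regroup₂ : ∀ A B D → A + B + D ≡ D + A + B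
    regroup₂ = solve-∀
    regroup₃ : ∀ w V k → (w + 3) * V + (w + 4) * k ≡ (w + 3) * (V + k) + k
    regroup₃ = solve-∀

  ∈-pairsEndingAt : ∀ L t {a} → T (χ (L + t)) → T (χ a) → L ≤ a → a < L + t → (a , L + t) ∈ pairsEndingAt L t
  ∈-pairsEndingAt L t χb χa L≤a a<L+t with χ (L + t)
  ... | true = ∈-map⁺ (_, L + t) (∈-filter⁺ χ? (∈-range⁺ L t L≤a a<L+t) χa)

  ∈-blockPairs : ∀ L m {a b} → T (χ a) → T (χ b) → L ≤ a → a < b → L + 2 ≤ b → b < L + 2 + m →
    (a , b) ∈ blockPairs L m
  ∈-blockPairs L zero    χa χb L≤a a<b L+2≤b b<L+2+0 = ⊥-elim (<⇒≱ (<-≤-trans b<L+2+0 (≤-reflexive (+-identityʳ (L + 2)))) L+2≤b)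
  ∈-blockPairs L (suc m) {a} {b} χa χb L≤a a<b L+2≤b b<L+2+1+m
    with m≤n⇒m<n∨m≡n (≤-pred (<-≤-trans b<L+2+1+m (≤-reflexive (+-suc (L + 2) m))))
  ... | inj₁ b<L+2+m = ∈-++⁺ˡ (∈-blockPairs L m χa χb L≤a a<b L+2≤b b<L+2+m)
  ... | inj₂ refl    = ∈-++⁺ʳ (blockPairs L m) (subst (λ z → (a , z) ∈ pairsEndingAt L (2 + m)) (sym (+-assoc L 2 m))
      (∈-pairsEndingAt L (2 + m) (subst (T ∘′ χ) (+-assoc L 2 m) χb) χa L≤a (<-≤-trans a<b (≤-reflexive (+-assoc L 2 m)))))

  ∈-chainPairs : ∀ w N J {a b} → J < N → T (χ a) → T (χ b) → J * w ≤ a → a < b → J * w + 2 ≤ b → b < J * w + 2 + w →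
    (a , b) ∈ chainPairs w N
  ∈-chainPairs w (suc N) J J<1+N χa χb Jw≤a a<b Jw+2≤b b<Jw+2+w with m≤n⇒m<n∨m≡n (≤-pred J<1+N)
  ... | inj₁ J<N  = ∈-++⁺ˡ (∈-chainPairs w N J J<N χa χb Jw≤a a<b Jw+2≤b b<Jw+2+w)
  ... | inj₂ refl = ∈-++⁺ʳ (chainPairs w N) (∈-blockPairs (J * w) w χa χb Jw≤a a<b Jw+2≤b b<Jw+2+w)

ChainPair : ℕ → List ℕ → ℕ × ℕ → Set
ChainPair w S p = proj₁ p ∈ S × proj₂ p ∈ S × proj₁ p < proj₂ p ×
  ∃ λ J → J * w ≤ proj₁ p × J * w + 2 ≤ proj₂ p × proj₂ p < J * w + 2 + w

module _ (S : List ℕ) where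

  open Counting (λ q → isYes (q ∈? S))

  length≡count : Unique S → ∀ M → (∀ {a} → a ∈ S → a < M) → length S ≡ count 0 M
  length≡count uS M S<M = trans (≤-antisym
      (Unique⇒length≤ S (filter χ? (range 0 M)) uS
        (λ a∈S → ∈-filter⁺ χ? (∈-range⁺ 0 M z≤n (S<M a∈S)) (fromWitness a∈S)))
      (Unique⇒length≤ (filter χ? (range 0 M)) S (Unique.filter⁺ χ? (Unique-range 0 M))
        (λ a∈ → toWitness (proj₂ (∈-filter⁻ χ? {xs = range 0 M} a∈)))))
    (length-filter-range 0 M)

  chainPair-bound : ∀ w → 1 ≤ w → (P : List (ℕ × ℕ)) → Unique S → Unique P →
    (∀ {p} → p ∈ P → ChainPair w S p) → 2 ≤ length S → 2 * length P + (w + 4) ≤ (w + 3) * length S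
  chainPair-bound w 1≤w P uS uP chain 2≤|S| = begin
    2 * length P + (w + 4)                                    ≤⟨ +-mono-≤ (*-monoʳ-≤ 2 |P|≤) (≤-reflexive (sym deficit≡)) ⟩
    2 * length (chainPairs w N) + deficit w (count 0 (N * w + 2)) ≤⟨ chainPairs-bound w N ⟩
    (w + 3) * count 0 (N * w + 2)                               ≡⟨ cong ((w + 3) *_) (sym |S|≡) ⟩
    (w + 3) * length S                                          ∎
    where
    open ≤-Reasoning
    N : ℕ
    N = suc (max 0 S)
    n≤n*w : ∀ n → n ≤ n * w
    n≤n*w n = subst (_≤ n * w) (*-identityʳ n) (*-monoʳ-≤ n 1≤w)
    ≤max : ∀ {a} → a ∈ S → a ≤ max 0 S
    ≤max a∈S = All.lookup (xs≤max 0 S) a∈S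
    |S|≡ : length S ≡ count 0 (N * w + 2)
    |S|≡ = length≡count uS (N * w + 2) (λ a∈S → ≤-trans (s≤s (≤max a∈S)) (≤-trans (n≤n*w N) (m≤m+n (N * w) 2)))
    deficit≡ : deficit w (count 0 (N * w + 2)) ≡ w + 4
    deficit≡ with count 0 (N * w + 2) | subst (2 ≤_) |S|≡ 2≤|S|
    ... | suc (suc _) | _ = refl
    ... | suc zero | s≤s ()
    |P|≤ : length P ≤ length (chainPairs w N)
    |P|≤ = Unique⇒length≤ P (chainPairs w N) uP λ p∈P → chainPair∈ (chain p∈P)
      where
      chainPair∈ : ∀ {p} → ChainPair w S p → p ∈ chainPairs w N
      chainPair∈ (a∈S , b∈S , a<b , J , Jw≤a , Jw+2≤b , b<Jw+2+w) =
        ∈-chainPairs w N J J<N (fromWitness a∈S) (fromWitness b∈S) Jw≤a a<b Jw+2≤b b<Jw+2+w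
        where
        J<N : J < N
        J<N = s≤s (≤-trans (≤-trans (n≤n*w J) (m≤m+n (J * w) 2)) (≤-trans Jw+2≤b (≤max b∈S)))

cliquePair⇒blockPair : ∀ w → 1 ≤ w → ∀ J {a b} → J * w ≤ a → a < b → b ≤ J * w + w + 1 → 2 ≤ b →
  ∃ λ J′ → J′ * w ≤ a × J′ * w + 2 ≤ b × b < J′ * w + 2 + w
cliquePair⇒blockPair w 1≤w J {a} {b} Jw≤a a<b b≤Jw+w+1 2≤b with J * w + 2 ≤? b
... | yes Jw+2≤b = J , Jw≤a , Jw+2≤b , ≤-trans (s≤s b≤Jw+w+1) (≤-reflexive (shift (J * w) w))
  where
  shift : ∀ x w → suc (x + w + 1) ≡ x + 2 + w
  shift = solve-∀
cliquePair⇒blockPair w 1≤w zero    Jw≤a a<b b≤Jw+w+1 2≤b | no b<2 = ⊥-elim (b<2 2≤b)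
cliquePair⇒blockPair w 1≤w (suc J) {a} {b} w+Jw≤a a<b b≤Jw+w+1 2≤b | no b≱w+Jw+2 =
  J , ≤-trans (m≤n+m (J * w) w) w+Jw≤a , Jw+2≤b , <-≤-trans (≰⇒> b≱w+Jw+2) (≤-reflexive (reorder (J * w) w))
  where
  open ≤-Reasoning
  reorder : ∀ x w → w + x + 2 ≡ x + 2 + w
  reorder = solve-∀
  Jw+2≤b : J * w + 2 ≤ b
  Jw+2≤b = begin
    J * w + 2     ≡⟨ +-comm (J * w) 2 ⟩
    2 + J * w     ≤⟨ +-monoˡ-≤ (J * w) (s≤s 1≤w) ⟩
    suc w + J * w ≤⟨ s≤s w+Jw≤a ⟩
    suc a         ≤⟨ a<b ⟩
    b             ∎

-- Cutting the cycle open

[m%n+o]%n≡[m+o]%n : ∀ m o n .{{_ : NonZero n}} → (m % n + o) % n ≡ (m + o) % n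
[m%n+o]%n≡[m+o]%n m o n = begin
  (m % n + o) % n           ≡⟨ %-distribˡ-+ (m % n) o n ⟩
  (m % n % n + o % n) % n   ≡⟨ cong (λ z → (z + o % n) % n) (m%n%n≡m%n m n) ⟩
  (m % n + o % n) % n       ≡⟨ sym (%-distribˡ-+ m o n) ⟩
  (m + o) % n               ∎
  where open ≡-Reasoning

module Rotation (n k w i₀ : ℕ) {{_ : NonZero n}} {{_ : NonZero k}} (n≡k*w : n ≡ k * w) (2≤w : 2 ≤ w) (i₀<k : i₀ < k) where

  s : ℕ
  s = i₀ * w

  s+w≤n : s + w ≤ n
  s+w≤n = ≤-trans (≤-reflexive (+-comm s w)) (≤-trans (*-monoˡ-≤ w i₀<k) (≤-reflexive (sym n≡k*w)))

  s+1<n : suc s < n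
  s+1<n = ≤-trans (≤-trans (≤-reflexive (sym (+-comm s 2))) (+-monoʳ-≤ s 2≤w)) s+w≤n

  s+[n∸s]≡n : s + (n ∸ s) ≡ n
  s+[n∸s]≡n = m+[n∸m]≡n (≤-trans (m≤m+n s w) s+w≤n)

  -- Sends the overlap {s, s + 1} to {0, 1}; away from these two positions no clique wraps around.
  rotate : ℕ → ℕ
  rotate x = (x + (n ∸ s)) % n

  [rotate+s]%n≡id : ∀ {x} → x < n → (rotate x + s) % n ≡ x
  [rotate+s]%n≡id {x} x<n = begin
    ((x + (n ∸ s)) % n + s) % n ≡⟨ [m%n+o]%n≡[m+o]%n (x + (n ∸ s)) s n ⟩
    (x + (n ∸ s) + s) % n       ≡⟨ cong (_% n) (trans (+-assoc x (n ∸ s) s) (cong (x +_) (trans (+-comm (n ∸ s) s) s+[n∸s]≡n))) ⟩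
    (x + n) % n                 ≡⟨ [m+n]%n≡m%n x n ⟩
    x % n                       ≡⟨ m<n⇒m%n≡m x<n ⟩
    x                           ∎
    where open ≡-Reasoning

  rotate-injective : ∀ {x y} → x < n → y < n → rotate x ≡ rotate y → x ≡ y
  rotate-injective x<n y<n eq =
    trans (sym ([rotate+s]%n≡id x<n)) (trans (cong (λ z → (z + s) % n) eq) ([rotate+s]%n≡id y<n))

  2≤rotate : ∀ {x} → x < n → ¬ x ≡ s → ¬ x ≡ suc s → 2 ≤ rotate x
  2≤rotate {x} x<n x≢s x≢1+s with rotate x | [rotate+s]%n≡id x<n
  ... | zero        | eq = ⊥-elim (x≢s (trans (sym eq) (m<n⇒m%n≡m (<-trans (n<1+n s) s+1<n))))
  ... | suc zero    | eq = ⊥-elim (x≢1+s (trans (sym eq) (m<n⇒m%n≡m s+1<n)))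
  ... | suc (suc _) | _  = s≤s (s≤s z≤n)

  clique : ℕ → ℕ
  clique i = (i + (k ∸ i₀)) % k

  clique*w+w≤n : ∀ i → clique i * w + w ≤ n
  clique*w+w≤n i = begin
    clique i * w + w ≡⟨ +-comm (clique i * w) w ⟩
    suc (clique i) * w ≤⟨ *-monoˡ-≤ w (m%n<n (i + (k ∸ i₀)) k) ⟩
    k * w            ≡⟨ sym n≡k*w ⟩
    n                ∎
    where open ≤-Reasoning

  rotate-%≡ : ∀ {x} i a → x ≡ (i * w + a) % n → rotate x ≡ (clique i * w + a) % n
  rotate-%≡ {x} i a refl = begin
    ((i * w + a) % n + (n ∸ s)) % n     ≡⟨ [m%n+o]%n≡[m+o]%n (i * w + a) (n ∸ s) n ⟩
    (i * w + a + (n ∸ s)) % n           ≡⟨ cong (λ z → (i * w + a + z) % n) n∸s≡ ⟩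
    (i * w + a + (k ∸ i₀) * w) % n      ≡⟨ cong (_% n) (regroup₁ i a (k ∸ i₀) w) ⟩
    (t * w + a) % n                     ≡⟨ cong (λ z → (z * w + a) % n) (m≡m%n+[m/n]*n t k) ⟩
    ((t % k + t / k * k) * w + a) % n   ≡⟨ cong (_% n) (regroup₂ (t % k) (t / k) k w a) ⟩
    (t % k * w + a + t / k * (k * w)) % n ≡⟨ cong (λ z → (t % k * w + a + t / k * z) % n) (sym n≡k*w) ⟩
    (t % k * w + a + t / k * n) % n     ≡⟨ [m+kn]%n≡m%n (t % k * w + a) (t / k) n ⟩
    (clique i * w + a) % n              ∎
    where
    open ≡-Reasoning
    t : ℕ
    t = i + (k ∸ i₀)
    n∸s≡ : n ∸ s ≡ (k ∸ i₀) * w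
    n∸s≡ = trans (cong (_∸ s) n≡k*w) (sym (*-distribʳ-∸ w k i₀))
    regroup₁ : ∀ i a t w → i * w + a + t * w ≡ (i + t) * w + a
    regroup₁ = solve-∀
    regroup₂ : ∀ j q k w a → (j + q * k) * w + a ≡ j * w + a + q * (k * w)
    regroup₂ = solve-∀

  2≤%⇒<n : ∀ y → y ≤ n + 1 → 2 ≤ y % n → y < n
  2≤%⇒<n y y≤n+1 2≤y%n with y <? n
  ... | yes y<n = y<n
  ... | no  y≮n with m≤n⇒∃[o]m+o≡n (≮⇒≥ y≮n)
  ...   | e , refl = ⊥-elim (<⇒≱ e<2 (≤-trans 2≤y%n (≤-trans (≤-reflexive (trans (cong (_% n) (+-comm n e)) ([m+n]%n≡m%n e n))) (m%n≤m e n))))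
    where
    e<2 : e < 2
    e<2 = s≤s (+-cancelˡ-≤ n e 1 y≤n+1)

  rotate-clique : ∀ {x} i a → x ≡ (i * w + a) % n → a < w + 2 → 2 ≤ rotate x → rotate x ≡ clique i * w + a
  rotate-clique i a x≡ a<w+2 2≤rotate-x =
    trans eq (m<n⇒m%n≡m (2≤%⇒<n (clique i * w + a) bound (subst (2 ≤_) eq 2≤rotate-x)))
    where
    eq : rotate _ ≡ (clique i * w + a) % n
    eq = rotate-%≡ i a x≡
    bound : clique i * w + a ≤ n + 1
    bound = ≤-trans (+-monoʳ-≤ (clique i * w) (≤-pred (≤-trans a<w+2 (≤-reflexive (+-suc w 1)))))
              (≤-trans (≤-reflexive (sym (+-assoc (clique i * w) w 1))) (+-monoˡ-≤ 1 (clique*w+w≤n i)))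

[a*w+t]/w≡a : ∀ a {t} w .{{_ : NonZero w}} → t < w → (a * w + t) / w ≡ a
[a*w+t]/w≡a a {t} w t<w = begin
  (a * w + t) / w   ≡⟨ +-distrib-/-∣ˡ t (divides a refl) ⟩
  a * w / w + t / w ≡⟨ cong₂ _+_ (m*n/n≡m a w) (m<n⇒m/n≡0 t<w) ⟩
  a + 0             ≡⟨ +-identityʳ a ⟩
  a                 ∎
  where open ≡-Reasoning

module Overlaps (w : ℕ) (2≤w : 2 ≤ w) (vs : List ℕ) where

  instance
    w≢0 : NonZero w
    w≢0 = >-nonZero (<-≤-trans (s≤s z≤n) 2≤w)

  Covered : ℕ → Set
  Covered i = i * w ∈ vs ⊎ suc (i * w) ∈ vs

  covered? : ∀ i → Dec (Covered i)
  covered? i = (i * w ∈? vs) ⊎-dec (suc (i * w) ∈? vs)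

  all-covered⇒k≤length : ∀ k → (∀ (i : Fin k) → Covered (toℕ i)) → k ≤ length vs
  all-covered⇒k≤length k covered = begin
      k                           ≡⟨ sym (trans (length-map witness (allFin k)) (length-tabulate id)) ⟩
      length (map witness (allFin k)) ≤⟨ Unique⇒length≤ _ vs (Unique-map⁺ witness (allFin k) (Unique.allFin⁺ k) (λ _ _ → witness-injective))
                                           witnesses⊆vs ⟩
      length vs                   ∎
    where
    open ≤-Reasoning
    witness : Fin k → ℕ
    witness i with covered i
    ... | inj₁ _ = toℕ i * w
    ... | inj₂ _ = suc (toℕ i * w)
    witness-spec : ∀ i → witness i ∈ vs × ∃ λ t → t < 2 × witness i ≡ toℕ i * w + t
    witness-spec i with covered i
    ... | inj₁ c = c , 0 , s≤s z≤n , sym (+-identityʳ _)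
    ... | inj₂ c = c , 1 , s≤s (s≤s z≤n) , sym (+-comm (toℕ i * w) 1)
    witnesses⊆vs : ∀ {x} → x ∈ map witness (allFin k) → x ∈ vs
    witnesses⊆vs x∈ with ∈-map⁻ witness x∈
    ... | i , _ , refl = proj₁ (witness-spec i)
    witness-injective : ∀ {i j} → witness i ≡ witness j → i ≡ j
    witness-injective {i} {j} eq with witness-spec i | witness-spec j
    ... | _ , t , t<2 , eqi | _ , t′ , t′<2 , eqj = toℕ-injective (begin-equality
      toℕ i                     ≡⟨ sym ([a*w+t]/w≡a (toℕ i) w (<-≤-trans t<2 2≤w)) ⟩
      (toℕ i * w + t) / w       ≡⟨ cong (_/ w) (trans (sym eqi) (trans eq eqj)) ⟩
      (toℕ j * w + t′) / w      ≡⟨ [a*w+t]/w≡a (toℕ j) w (<-≤-trans t′<2 2≤w) ⟩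
      toℕ j                     ∎)

  uncovered : ∀ k → length vs < k → ∃ λ i → i < k × ¬ Covered i
  uncovered k |vs|<k with all? (λ (i : Fin k) → covered? (toℕ i))
  ... | yes all-covered = ⊥-elim (<⇒≱ |vs|<k (all-covered⇒k≤length k all-covered))
  ... | no ¬all-covered with ¬∀⟶∃¬ k (λ i → Covered (toℕ i)) (λ i → covered? (toℕ i)) ¬all-covered
  ...   | i , ¬covered = toℕ i , toℕ<n i , ¬covered

-- Vertices and components of I

module _ {n : ℕ} (es : List (Edge n)) where

  inV? : ∀ v → Dec (InV es v)
  inV? v = any? (λ e → (v Fin.≟ proj₁ e) ⊎-dec (v Fin.≟ proj₂ e)) es

  vertices : List (Fin n)
  vertices = filter inV? (allFin n)

  Unique-vertices : Unique vertices
  Unique-vertices = Unique.filter⁺ inV? (Unique.allFin⁺ n)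

  ∈-vertices⁺ : ∀ {v} → InV es v → v ∈ vertices
  ∈-vertices⁺ {v} = ∈-filter⁺ inV? (∈-allFin v)

  ∈-vertices⁻ : ∀ {v} → v ∈ vertices → InV es v
  ∈-vertices⁻ v∈ = proj₂ (∈-filter⁻ inV? {xs = allFin n} v∈)

  InV-endpoints : ∀ {e} → e ∈ es → InV es (proj₁ e) × InV es (proj₂ e)
  InV-endpoints e∈ = Any.map (λ { refl → inj₁ refl }) e∈ , Any.map (λ { refl → inj₂ refl }) e∈

  numV≤2*length : numV es ≤ 2 * length es
  numV≤2*length = subst (numV es ≤_) (length-endpoints es)
    (Unique⇒length≤ vertices (endpoints es) Unique-vertices (λ v∈ → ∈-endpoints es (∈-vertices⁻ v∈)))
    where
    endpoints : List (Edge n) → List (Fin n)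
    endpoints []       = []
    endpoints (e ∷ xs) = proj₁ e ∷ proj₂ e ∷ endpoints xs
    length-endpoints : ∀ xs → length (endpoints xs) ≡ 2 * length xs
    length-endpoints []       = refl
    length-endpoints (e ∷ xs) = trans (cong (2 +_) (length-endpoints xs)) (sym (*-suc 2 (length xs)))
    ∈-endpoints : ∀ {v} xs → InV xs v → v ∈ endpoints xs
    ∈-endpoints (e ∷ xs) (here (inj₁ refl)) = here refl
    ∈-endpoints (e ∷ xs) (here (inj₂ refl)) = there (here refl)
    ∈-endpoints (e ∷ xs) (there p)          = there (there (∈-endpoints xs p))

2ℓ<k : ∀ ℓ k w → 1 ≤ ℓ → ℓ * (2 * (w + 2)) ≤ k * w → 2 * ℓ < k
2ℓ<k ℓ k w 1≤ℓ ℓ[2w+4]≤kw with 2 * ℓ <? k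
... | yes 2ℓ<k = 2ℓ<k
... | no  2ℓ≮k = ⊥-elim (<⇒≱ (≤-trans (s≤s z≤n) (*-monoʳ-≤ 4 1≤ℓ)) (+-cancelˡ-≤ (2 * ℓ * w) (4 * ℓ) 0 (begin
  2 * ℓ * w + 4 * ℓ  ≡⟨ expand ℓ w ⟩
  ℓ * (2 * (w + 2)) ≤⟨ ℓ[2w+4]≤kw ⟩
  k * w             ≤⟨ *-monoˡ-≤ w (≮⇒≥ 2ℓ≮k) ⟩
  2 * ℓ * w         ≡⟨ sym (+-identityʳ _) ⟩
  2 * ℓ * w + 0     ∎)))
  where
  open ≤-Reasoning
  expand : ∀ ℓ w → 2 * ℓ * w + 4 * ℓ ≡ ℓ * (2 * (w + 2))
  expand = solve-∀

module Linearisation (r m k′ : ℕ) (4≤r : 4 ≤ r) (n≡k*w : suc m ≡ suc k′ * (r ∸ 2))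
  (es : List (Edge (suc m))) (subgraph : IsSubgraph r (suc m) es)
  (ℓ*2r≤n : length es * (2 * r) ≤ suc m) (1≤ℓ : 1 ≤ length es) where

  n k w : ℕ
  n = suc m
  k = suc k′
  w = r ∸ 2

  r≡w+2 : r ≡ w + 2
  r≡w+2 = sym (m∸n+n≡m (≤-trans (s≤s (s≤s z≤n)) 4≤r))

  2≤w : 2 ≤ w
  2≤w = +-cancelʳ-≤ 2 2 w (subst (4 ≤_) r≡w+2 4≤r)

  |vertices|<k : length (map toℕ (vertices es)) < k
  |vertices|<k = begin-strict
    length (map toℕ (vertices es)) ≡⟨ length-map toℕ (vertices es) ⟩
    numV es                        ≤⟨ numV≤2*length es ⟩
    2 * length es                  <⟨ 2ℓ<k (length es) k w 1≤ℓ (subst (_≤ k * w) ℓ*2r≡ (subst (length es * (2 * r) ≤_) n≡k*w ℓ*2r≤n)) ⟩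
    k                              ∎
    where
    open ≤-Reasoning
    ℓ*2r≡ : length es * (2 * r) ≡ length es * (2 * (w + 2))
    ℓ*2r≡ = cong (λ x → length es * (2 * x)) r≡w+2

  open Overlaps w 2≤w (map toℕ (vertices es)) using (Covered; uncovered)

  cut : ∃ λ i₀ → i₀ < k × ¬ Covered i₀
  cut = uncovered k |vertices|<k

  open Rotation n k w (proj₁ cut) n≡k*w 2≤w (proj₁ (proj₂ cut))

  opaque
    pos : Fin n → ℕ
    pos u = rotate (toℕ u)

    pos≡rotate : ∀ u → pos u ≡ rotate (toℕ u)
    pos≡rotate u = refl

  pos-injective : ∀ {u v} → pos u ≡ pos v → u ≡ v
  pos-injective {u} {v} eq =
    toℕ-injective (rotate-injective (toℕ<n u) (toℕ<n v) (trans (sym (pos≡rotate u)) (trans eq (pos≡rotate v))))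

  2≤pos : ∀ {u} → InV es u → 2 ≤ pos u
  2≤pos {u} u∈V = subst (2 ≤_) (sym (pos≡rotate u)) (2≤rotate (toℕ<n u)
    (λ u≡s → proj₂ (proj₂ cut) (inj₁ (subst (_∈ _) u≡s toℕu∈)))
    (λ u≡s+1 → proj₂ (proj₂ cut) (inj₂ (subst (_∈ _) u≡s+1 toℕu∈))))
    where
    toℕu∈ : toℕ u ∈ map toℕ (vertices es)
    toℕu∈ = ∈-map⁺ toℕ (∈-vertices⁺ es u∈V)

  edge-ok : ∀ {e} → e ∈ es → toℕ (proj₁ e) < toℕ (proj₂ e) × Adj r n (proj₁ e) (proj₂ e)
  edge-ok = All.lookup (proj₂ subgraph)

  edge-≢ : ∀ {e} → e ∈ es → ¬ proj₁ e ≡ proj₂ e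
  edge-≢ e∈ eq = <-irrefl (cong toℕ eq) (proj₁ (edge-ok e∈))

  InWindow : ℕ → ℕ → Set
  InWindow J x = J * w ≤ x × x ≤ J * w + w + 1

  pos-in-clique : ∀ {u} i a → a < r → toℕ u ≡ (i * w + a) % n → InV es u → InWindow (clique i) (pos u)
  pos-in-clique {u} i a a<r u≡ u∈V =
    subst (clique i * w ≤_) (sym pos≡) (m≤m+n _ a) ,
    subst (_≤ clique i * w + w + 1) (sym pos≡)
      (≤-trans (+-monoʳ-≤ (clique i * w) (≤-pred (≤-trans a<w+2 (≤-reflexive (+-suc w 1)))))
               (≤-reflexive (sym (+-assoc (clique i * w) w 1))))
    where
    a<w+2 : a < w + 2
    a<w+2 = subst (a <_) r≡w+2 a<r
    pos≡ : pos u ≡ clique i * w + a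
    pos≡ = trans (pos≡rotate u) (rotate-clique i a u≡ a<w+2 (subst (2 ≤_) (pos≡rotate u) (2≤pos u∈V)))

  edge-in-window : ∀ {e} → e ∈ es → ∃ λ J → InWindow J (pos (proj₁ e)) × InWindow J (pos (proj₂ e))
  edge-in-window e∈ with edge-ok e∈ | InV-endpoints es e∈
  ... | _ , _ , i , _ , (a , a<r , u≡) , (b , b<r , v≡) | u∈V , v∈V =
    clique i , pos-in-clique i a a<r u≡ u∈V , pos-in-clique i b b<r v≡ v∈V

  pair : Edge n → ℕ × ℕ
  pair (u , v) with pos u <? pos v
  ... | yes _ = pos u , pos v
  ... | no  _ = pos v , pos u

  PairCases : Fin n → Fin n → Set
  PairCases u v = (pair (u , v) ≡ (pos u , pos v) × pos u < pos v) ⊎ (pair (u , v) ≡ (pos v , pos u) × pos v < pos u)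

  pair-cases : ∀ u v → ¬ u ≡ v → PairCases u v
  pair-cases u v u≢v with pos u <? pos v
  ... | yes pu<pv = inj₁ (refl , pu<pv)
  ... | no  pu≮pv with m≤n⇒m<n∨m≡n (≮⇒≥ pu≮pv)
  ...   | inj₁ pv<pu = inj₂ (refl , pv<pu)
  ...   | inj₂ pv≡pu = ⊥-elim (u≢v (pos-injective (sym pv≡pu)))

  pos-pair-injective : ∀ {u v u′ v′} → (pos u , pos v) ≡ (pos u′ , pos v′) → (u , v) ≡ (u′ , v′)
  pos-pair-injective eq = cong₂ _,_ (pos-injective (,-injectiveˡ eq)) (pos-injective (,-injectiveʳ eq))

  edges-not-reversed : ∀ {u v u′ v′} → (u , v) ∈ es → (u′ , v′) ∈ es → ¬ (u , v) ≡ (v′ , u′)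
  edges-not-reversed e∈ e′∈ refl = <-asym (proj₁ (edge-ok e∈)) (proj₁ (edge-ok e′∈))

  pair-injective : ∀ {e e′} → e ∈ es → e′ ∈ es → pair e ≡ pair e′ → e ≡ e′
  pair-injective {u , v} {u′ , v′} e∈ e′∈ eq = by-cases (pair-cases u v (edge-≢ e∈)) (pair-cases u′ v′ (edge-≢ e′∈))
    where
    by-cases : PairCases u v → PairCases u′ v′ → (u , v) ≡ (u′ , v′)
    by-cases (inj₁ (p≡ , _)) (inj₁ (p′≡ , _)) = pos-pair-injective (trans (sym p≡) (trans eq p′≡))
    by-cases (inj₂ (p≡ , _)) (inj₂ (p′≡ , _)) = cong swap (pos-pair-injective (trans (sym p≡) (trans eq p′≡)))
    by-cases (inj₁ (p≡ , _)) (inj₂ (p′≡ , _)) =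
      ⊥-elim (edges-not-reversed e∈ e′∈ (pos-pair-injective (trans (sym p≡) (trans eq p′≡))))
    by-cases (inj₂ (p≡ , _)) (inj₁ (p′≡ , _)) =
      ⊥-elim (edges-not-reversed e∈ e′∈ (cong swap (pos-pair-injective (trans (sym p≡) (trans eq p′≡)))))

  1≤w : 1 ≤ w
  1≤w = ≤-trans (s≤s z≤n) 2≤w

  pair-chainPair : ∀ {e} (S : List ℕ) → e ∈ es → pos (proj₁ e) ∈ S → pos (proj₂ e) ∈ S → ChainPair w S (pair e)
  pair-chainPair {u , v} S e∈ pu∈S pv∈S = by-cases (edge-in-window e∈) (pair-cases u v (edge-≢ e∈))
    where
    u∈V : InV es u
    u∈V = proj₁ (InV-endpoints es e∈)
    v∈V : InV es v
    v∈V = proj₂ (InV-endpoints es e∈)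
    by-cases : (∃ λ J → InWindow J (pos u) × InWindow J (pos v)) → PairCases u v → ChainPair w S (pair (u , v))
    by-cases (J , Wu , Wv) (inj₁ (p≡ , pu<pv)) = subst (ChainPair w S) (sym p≡)
      (pu∈S , pv∈S , pu<pv , cliquePair⇒blockPair w 1≤w J (proj₁ Wu) pu<pv (proj₂ Wv) (2≤pos v∈V))
    by-cases (J , Wu , Wv) (inj₂ (p≡ , pv<pu)) = subst (ChainPair w S) (sym p≡)
      (pv∈S , pu∈S , pv<pu , cliquePair⇒blockPair w 1≤w J (proj₁ Wv) pv<pu (proj₂ Wu) (2≤pos u∈V))

  module Components (c : ℕ) (nc : NumComponents es c) where

    label : VI es → Fin c
    label = proj₁ nc

    -- 0 is a junk value for vertices outside V(I).
    component : Fin n → ℕ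
    component v with inV? es v
    ... | yes v∈V = toℕ (label (v , v∈V))
    ... | no  _   = 0

    component≡ : ∀ {v} (v∈V : InV es v) → component v ≡ toℕ (label (v , v∈V))
    component≡ {v} v∈V with inV? es v
    ... | yes v∈V′ = cong toℕ (Equivalence.from (proj₂ (proj₂ nc) (v , v∈V′) (v , v∈V)) ε)
    ... | no  v∉V  = ⊥-elim (v∉V v∈V)

    component<c : ∀ {v} → InV es v → component v < c
    component<c v∈V = subst (_< c) (sym (component≡ v∈V)) (toℕ<n _)

    component-edge : ∀ {e} → e ∈ es → component (proj₁ e) ≡ component (proj₂ e)
    component-edge {e} e∈ = begin
      component (proj₁ e)            ≡⟨ component≡ u∈V ⟩
      toℕ (label (proj₁ e , u∈V))    ≡⟨ cong toℕ (Equivalence.from (proj₂ (proj₂ nc) (_ , u∈V) (_ , v∈V)) (step ◅ ε)) ⟩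
      toℕ (label (proj₂ e , v∈V))    ≡⟨ sym (component≡ v∈V) ⟩
      component (proj₂ e)            ∎
      where
      open ≡-Reasoning
      u∈V : InV es (proj₁ e)
      u∈V = proj₁ (InV-endpoints es e∈)
      v∈V : InV es (proj₂ e)
      v∈V = proj₂ (InV-endpoints es e∈)
      step : Step es (proj₁ e) (proj₂ e)
      step = Any.map (λ { refl → inj₁ (refl , refl) }) e∈

    Vs : ℕ → List (Fin n)
    Vs j = fibre component j (vertices es)

    Es : ℕ → List (Edge n)
    Es j = fibre (component ∘′ proj₁) j es

    pos∈ : ∀ {j u} → InV es u → component u ≡ j → pos u ∈ map pos (Vs j)
    pos∈ {j} u∈V cu≡j = ∈-map⁺ pos (∈-filter⁺ (λ x → component x ℕ.≟ j) (∈-vertices⁺ es u∈V) cu≡j)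

    2≤|Vs| : ∀ j → j < c → 2 ≤ length (map pos (Vs j))
    2≤|Vs| j j<c with proj₁ (proj₂ nc) (Fin.fromℕ< j<c)
    ... | (v , v∈V) , label≡ = neighbour (find v∈V)
      where
      cv≡j : component v ≡ j
      cv≡j = trans (component≡ v∈V) (trans (cong toℕ (label≡ refl)) (toℕ-fromℕ< j<c))
      neighbour : ∃ (λ e → e ∈ es × Incident v e) → 2 ≤ length (map pos (Vs j))
      neighbour (e , e∈ , inj₁ refl) = 2≤length (edge-≢ e∈ ∘′ pos-injective) (pos∈ v∈V cv≡j)
        (pos∈ (proj₂ (InV-endpoints es e∈)) (trans (sym (component-edge e∈)) cv≡j))
      neighbour (e , e∈ , inj₂ refl) = 2≤length (edge-≢ e∈ ∘′ sym ∘′ pos-injective) (pos∈ v∈V cv≡j)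
        (pos∈ (proj₁ (InV-endpoints es e∈)) (trans (component-edge e∈) cv≡j))

    component-bound : ∀ j → j < c → 2 * length (Es j) + (w + 4) ≤ (w + 3) * length (Vs j)
    component-bound j j<c = subst₂ (λ a b → 2 * a + (w + 4) ≤ (w + 3) * b) (length-map pair (Es j)) (length-map pos (Vs j))
      (chainPair-bound (map pos (Vs j)) w 1≤w (map pair (Es j)) Unique-positions Unique-pairs pairs-chain (2≤|Vs| j j<c))
      where
      Unique-positions : Unique (map pos (Vs j))
      Unique-positions = Unique-map⁺ pos (Vs j) (Unique.filter⁺ _ (Unique-vertices es)) (λ _ _ → pos-injective)
      Es⊆es : ∀ {e} → e ∈ Es j → e ∈ es
      Es⊆es e∈Es = proj₁ (∈-filter⁻ (λ e → component (proj₁ e) ℕ.≟ j) e∈Es)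
      Unique-pairs : Unique (map pair (Es j))
      Unique-pairs = Unique-map⁺ pair (Es j) (Unique.filter⁺ _ (proj₁ subgraph))
        (λ e∈ e′∈ → pair-injective (Es⊆es e∈) (Es⊆es e′∈))
      pairs-chain : ∀ {p} → p ∈ map pair (Es j) → ChainPair w (map pos (Vs j)) p
      pairs-chain p∈ with ∈-map⁻ pair p∈
      ... | e , e∈Es , refl with ∈-filter⁻ (λ e → component (proj₁ e) ℕ.≟ j) e∈Es
      ...   | e∈ , cu≡j = pair-chainPair _ e∈ (pos∈ (proj₁ (InV-endpoints es e∈)) cu≡j)
                            (pos∈ (proj₂ (InV-endpoints es e∈)) (trans (sym (component-edge e∈)) cu≡j))

    edges-bound : 2 * length es + c * (w + 4) ≤ (w + 3) * numV es
    edges-bound = begin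
      2 * length es + c * (w + 4)
        ≡⟨ cong₂ (λ a b → 2 * a + b) |es|≡∑ (sym (∑-const c (w + 4))) ⟩
      2 * ∑< c (λ j → length (Es j)) + ∑< c (λ _ → w + 4)
        ≡⟨ cong (_+ ∑< c (λ _ → w + 4)) (sym (∑-*ˡ c 2 (λ j → length (Es j)))) ⟩
      ∑< c (λ j → 2 * length (Es j)) + ∑< c (λ _ → w + 4)
        ≡⟨ sym (∑-+ c (λ j → 2 * length (Es j)) (λ _ → w + 4)) ⟩
      ∑< c (λ j → 2 * length (Es j) + (w + 4))
        ≤⟨ ∑-mono-≤ c component-bound ⟩
      ∑< c (λ j → (w + 3) * length (Vs j))
        ≡⟨ ∑-*ˡ c (w + 3) (λ j → length (Vs j)) ⟩
      (w + 3) * ∑< c (λ j → length (Vs j))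
        ≡⟨ cong ((w + 3) *_) (sym |V|≡∑) ⟩
      (w + 3) * numV es ∎
      where
      open ≤-Reasoning
      |es|≡∑ : length es ≡ ∑< c (λ j → length (Es j))
      |es|≡∑ = length≡∑-fibres (component ∘′ proj₁) c es (λ e∈ → component<c (proj₁ (InV-endpoints es e∈)))
      |V|≡∑ : numV es ≡ ∑< c (λ j → length (Vs j))
      |V|≡∑ = length≡∑-fibres component c (vertices es) (λ v∈ → component<c (∈-vertices⁻ es v∈))

lemma3p12 : (r n : ℕ) → 4 ≤ r → (r ∸ 2) ∣ n →
    (es : List (Edge n)) → IsSubgraph r n es →
    (c : ℕ) → NumComponents es c →
    length es * (2 * r) ≤ n →
    2 * length es + c + (r + 1) * c ≤ (r + 1) * numV es
lemma3p12 r n _ _ [] _ zero _ _ = *-monoʳ-≤ (r + 1) z≤n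
lemma3p12 r n _ _ [] _ (suc c) (_ , surjective , _) _ with surjective Fin.zero
... | (_ , ()) , _
lemma3p12 r zero _ _ ((() , _) ∷ _) _ _ _ _
lemma3p12 r (suc m) _ (divides zero ()) (_ ∷ _) _ _ _ _
lemma3p12 r (suc m) 4≤r (divides (suc k′) n≡k*w) es@(_ ∷ _) subgraph c nc ℓ*2r≤n = begin
  2 * length es + c + (r + 1) * c     ≡⟨ cong (λ x → 2 * length es + c + (x + 1) * c) r≡w+2 ⟩
  2 * length es + c + (w + 2 + 1) * c ≡⟨ regroup (length es) c w ⟩
  2 * length es + c * (w + 4)         ≤⟨ edges-bound ⟩
  (w + 3) * numV es                   ≡⟨ cong (_* numV es) (sym (+-assoc w 2 1)) ⟩
  (w + 2 + 1) * numV es               ≡⟨ cong (λ x → (x + 1) * numV es) (sym r≡w+2) ⟩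
  (r + 1) * numV es                   ∎
  where
  open ≤-Reasoning
  open Linearisation r m k′ 4≤r n≡k*w es subgraph ℓ*2r≤n (s≤s z≤n)
  open Components c nc
  regroup : ∀ ℓ c w → 2 * ℓ + c + (w + 2 + 1) * c ≡ 2 * ℓ + c * (w + 4)
  regroup = solve-∀
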